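{- Let $A$ be an $m$-by-$n$ $(0,1,\ast)$-matrix, let $s$ be the maximum number of stars in a row of $A$, and let $L\subseteq\{0,1\}^n$ be a solution for $A$. If $L$ contains a linear subspace $W$ of co-distance at least $s+1$, then $L$ is contained in some linear solution for $A$.
   Context: A $(0,1,\ast)$-matrix is a matrix with entries in $\{0,1,\ast\}$; all arithmetic is over $GF_2$. A completion of $A$ is a $(0,1)$-matrix obtained from $A$ by replacing each $\ast$ by $0$ or $1$. For $A=(a_{ij})$, an operator $G=(g_1,\dots,g_m):\{0,1\}^n\to\{0,1\}^m$ is consistent with $A$ if each $g_i$ depends only on the variables $x_j$ with $a_{ij}=\ast$. A set $L\subseteq\{0,1\}^n$ is a solution for $A$ if there exist a completion $M$ of $A$ and an operator $G$ consistent with $A$ such that $M\mathbf{x}=G(\mathbf{x})$ for all $\mathbf{x}\in L$; a solution is linear if it is a linear subspace of $GF_2^n$. The co-distance of a linear subspace $W\subseteq GF_2^n$ is the smallest number of $1$'s in a nonzero vector of its orthogonal complement $W^\perp=\{\mathbf{y}:\langle\mathbf{x},\mathbf{y}\rangle=0\ \forall\mathbf{x}\in W\}$ (taken as $+\infty$ if $W^\perp=\{\mathbf{0}\}$). -}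

module Defs where

open import Data.Nat using (ℕ; zero; suc; _+_; _⊔_; _≤_)
open import Data.Bool using (Bool; true; false; _xor_; _∧_)
open import Data.Fin using (Fin)
open import Data.Product using (Σ; _×_; ∃)
open import Relation.Binary.PropositionalEquality using (_≡_)
open import Relation.Nullary using (¬_)
open import Level using (Level; suc) renaming (zero to lzero)

data Entry : Set where
  𝟘 𝟙 ★ : Entry

Matrix01★ : ℕ → ℕ → Set
Matrix01★ m n = Fin m → Fin n → Entry

-- vectors of GF(2)^n (Bool with xor as addition, ∧ as multiplication)
Vec2 : ℕ → Set
Vec2 n = Fin n → Bool

sumℕ : ∀ {n} → (Fin n → ℕ) → ℕ
sumℕ {zero}  f = 0
sumℕ {suc n} f = f Fin.zero + sumℕ (λ j → f (Fin.suc j))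

xorSum : ∀ {n} → (Fin n → Bool) → Bool
xorSum {zero}  f = false
xorSum {suc n} f = f Fin.zero xor xorSum (λ j → f (Fin.suc j))

maxℕ : ∀ {m} → (Fin m → ℕ) → ℕ
maxℕ {zero}  f = 0
maxℕ {suc m} f = f Fin.zero ⊔ maxℕ (λ i → f (Fin.suc i))

⟨_,_⟩ : ∀ {n} → Vec2 n → Vec2 n → Bool
⟨ x , y ⟩ = xorSum (λ j → x j ∧ y j)

weight : ∀ {n} → Vec2 n → ℕ
weight x = sumℕ (λ j → if x j then 1 else 0)
  where open import Data.Bool using (if_then_else_)

isStar : Entry → ℕ
isStar ★ = 1
isStar 𝟘 = 0
isStar 𝟙 = 0

maxStars : ∀ {m n} → Matrix01★ m n → ℕ
maxStars A = maxℕ (λ i → sumℕ (λ j → isStar (A i j)))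

IsCompletion : ∀ {m n} → Matrix01★ m n → (Fin m → Fin n → Bool) → Set
IsCompletion A M = ∀ i j → (A i j ≡ 𝟘 → M i j ≡ false) × (A i j ≡ 𝟙 → M i j ≡ true)

IsConsistent : ∀ {m n} → Matrix01★ m n → (Vec2 n → Vec2 m) → Set
IsConsistent A G = ∀ i (x y : Vec2 _) → (∀ j → A i j ≡ ★ → x j ≡ y j) → G x i ≡ G y i

_·_ : ∀ {m n} → (Fin m → Fin n → Bool) → Vec2 n → Vec2 m
(M · x) i = ⟨ M i , x ⟩

Subset2 : ℕ → Set₁
Subset2 n = Vec2 n → Set

IsSolution : ∀ {m n} → Matrix01★ m n → Subset2 n → Set
IsSolution {m} {n} A L =
  Σ (Fin m → Fin n → Bool) λ M → Σ (Vec2 n → Vec2 m) λ G →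
    IsCompletion A M × IsConsistent A G × (∀ x → L x → ∀ i → (M · x) i ≡ G x i)

_⊆_ : ∀ {n} → Subset2 n → Subset2 n → Set
L ⊆ L' = ∀ x → L x → L' x

-- linear subspace of GF2^n (over GF2: contains 0 and closed under addition)
IsSubspace : ∀ {n} → Subset2 n → Set
IsSubspace W = W (λ _ → false) × (∀ x y → W x → W y → W (λ j → x j xor y j))

_⊥ : ∀ {n} → Subset2 n → Subset2 n
(W ⊥) y = ∀ x → W x → ⟨ x , y ⟩ ≡ false

-- co-distance of W is at least d: every nonzero y ∈ W^⊥ has weight ≥ d
-- (vacuous if W^⊥ = {0}, matching co-distance +∞)
CoDistanceAtLeast : ∀ {n} → Subset2 n → ℕ → Set
CoDistanceAtLeast W d = ∀ y → (W ⊥) y → ¬ (∀ j → y j ≡ false) → d ≤ weight y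

IsLinearSolution : ∀ {m n} → Matrix01★ m n → Subset2 n → Set
IsLinearSolution A L = IsSubspace L × IsSolution A L

-- For a row i with star set σᵢ, the operator value gᵢ(x) only sees x on σᵢ.
-- If every pattern on σᵢ is the restriction of some w ∈ W, then gᵢ(x) = Mᵢ·w for
-- any such w, so gᵢ is additive and {x | Mx = G(x)} is a linear solution containing L.
-- That W projects onto every coordinate set σ with |σ| ≤ s follows from the
-- co-distance: coordinates are added one at a time, and if some coordinate k could
-- not be reached, then e_k corrected by a dual basis of W on the coordinates
-- already reached would be a nonzero vector of W^⊥ supported in σ.
-- Since W is an arbitrary predicate, surjectivity holds only up to double negation,
-- which suffices because the conclusions are equalities of booleans.
module Submission where

open import Defs
open import Data.Nat using (ℕ; suc)
open import Data.Product using (Σ; _×_)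

open import Data.Nat using (zero; _+_; _≤_; z≤n)
open import Data.Nat.Properties
  using (≤-trans; ≤-reflexive; ≤⇒≯; m≤m⊔n; m≤n⊔m; +-mono-≤)
open import Data.Bool using (Bool; true; false; _xor_; _∧_; _∨_; not; if_then_else_; _≟_)
open import Data.Bool.Properties
  using (xor-identityʳ; xor-comm; xor-same; true-xor; ∧-identityʳ; ∧-zeroʳ; ∧-assoc;
         ∧-distribˡ-xor; ∨-zeroʳ; ¬-not; xor-∧-commutativeRing)
open import Data.Fin as Fin using (Fin)
open import Data.List using (List; []; _∷_; filter; allFin)
open import Data.List.Relation.Unary.Any using (here; there)
open import Data.List.Membership.Propositional using (_∈_)
open import Data.List.Membership.Propositional.Properties using (∈-filter⁺; ∈-filter⁻; ∈-allFin)
open import Data.Product using (∃; _,_; proj₁; proj₂)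
open import Function using (_∘_)
open import Algebra.Bundles using (CommutativeRing)
open import Algebra.Properties.CommutativeSemigroup
  (CommutativeRing.+-commutativeSemigroup xor-∧-commutativeRing) using (interchange)
open import Relation.Nullary using (¬_; yes; no)
open import Relation.Nullary.Decidable using (decidable-stable)
open import Relation.Nullary.Negation using (contradiction; ¬¬-Monad)
open import Effect.Monad using (RawMonad)
open import Level using (0ℓ)
open import Relation.Binary.PropositionalEquality
  using (_≡_; refl; sym; trans; cong; cong₂; subst; module ≡-Reasoning)

open RawMonad (¬¬-Monad {0ℓ}) using (_>>=_; pure)
open ≡-Reasoning

¬¬-pull-Fin : ∀ {n} {P : Fin n → Set} → (∀ j → ¬ ¬ P j) → ¬ ¬ (∀ j → P j)
¬¬-pull-Fin {zero} _ = pure λ ()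
¬¬-pull-Fin {suc n} {P} h = do
  p₀ ← h Fin.zero
  ps ← ¬¬-pull-Fin {P = P ∘ Fin.suc} (h ∘ Fin.suc)
  pure λ { Fin.zero → p₀ ; (Fin.suc j) → ps j }

module _ {n : ℕ} where

  _⊕_ : Vec2 n → Vec2 n → Vec2 n
  (x ⊕ y) j = x j xor y j

  𝟎 : Vec2 n
  𝟎 _ = false

  _⊑_ : Vec2 n → Vec2 n → Set
  ρ ⊑ σ = ∀ j → ρ j ≡ true → σ j ≡ true

  AgreeOn : Vec2 n → Vec2 n → Vec2 n → Set
  AgreeOn ρ w z = ∀ j → ρ j ≡ true → w j ≡ z j

unit : ∀ {n} → Fin n → Vec2 n
unit Fin.zero    Fin.zero    = true
unit Fin.zero    (Fin.suc _) = false
unit (Fin.suc _) Fin.zero    = false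
unit (Fin.suc k) (Fin.suc j) = unit k j

unit-self : ∀ {n} (k : Fin n) → unit k k ≡ true
unit-self Fin.zero    = refl
unit-self (Fin.suc k) = unit-self k

unit-sym : ∀ {n} (k j : Fin n) → unit k j ≡ unit j k
unit-sym Fin.zero    Fin.zero    = refl
unit-sym Fin.zero    (Fin.suc _) = refl
unit-sym (Fin.suc _) Fin.zero    = refl
unit-sym (Fin.suc k) (Fin.suc j) = unit-sym k j

unit⇒≡ : ∀ {n} {k j : Fin n} → unit k j ≡ true → k ≡ j
unit⇒≡ {k = Fin.zero}  {Fin.zero}  _ = refl
unit⇒≡ {k = Fin.suc k} {Fin.suc j} h = cong Fin.suc (unit⇒≡ h)

insert : ∀ {n} → Fin n → Vec2 n → Vec2 n
insert k ρ j = unit k j ∨ ρ j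

ρ⊑insert : ∀ {n} (k : Fin n) (ρ : Vec2 n) → ρ ⊑ insert k ρ
ρ⊑insert k ρ j ρⱼ = trans (cong (unit k j ∨_) ρⱼ) (∨-zeroʳ (unit k j))

insert⊑ρ : ∀ {n} {k : Fin n} {ρ : Vec2 n} → ρ k ≡ true → insert k ρ ⊑ ρ
insert⊑ρ {k = k} {ρ} ρₖ j h with unit k j in u
... | true  = subst (λ l → ρ l ≡ true) (unit⇒≡ u) ρₖ
... | false = h

xorSum-cong : ∀ {n} {f g : Fin n → Bool} → (∀ j → f j ≡ g j) → xorSum f ≡ xorSum g
xorSum-cong {zero}  _ = refl
xorSum-cong {suc n} h = cong₂ _xor_ (h Fin.zero) (xorSum-cong (h ∘ Fin.suc))

xorSum-false : ∀ {n} → xorSum {n} 𝟎 ≡ false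
xorSum-false {zero}  = refl
xorSum-false {suc n} = xorSum-false {n}

xorSum-xor : ∀ {n} (f g : Fin n → Bool) → xorSum (f ⊕ g) ≡ xorSum f xor xorSum g
xorSum-xor {zero}  f g = refl
xorSum-xor {suc n} f g =
  trans (cong ((f Fin.zero xor g Fin.zero) xor_) (xorSum-xor (f ∘ Fin.suc) (g ∘ Fin.suc)))
        (interchange (f Fin.zero) (g Fin.zero) _ _)

xorSum-unit : ∀ {n} (f : Fin n → Bool) (l : Fin n) → xorSum (λ j → f j ∧ unit j l) ≡ f l
xorSum-unit {suc n} f Fin.zero = begin
  f Fin.zero ∧ true xor xorSum (λ j → f (Fin.suc j) ∧ false)
    ≡⟨ cong₂ _xor_ (∧-identityʳ (f Fin.zero)) (trans (xorSum-cong (∧-zeroʳ ∘ f ∘ Fin.suc)) (xorSum-false {n})) ⟩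
  f Fin.zero xor false
    ≡⟨ xor-identityʳ (f Fin.zero) ⟩
  f Fin.zero ∎
xorSum-unit {suc n} f (Fin.suc l) =
  cong₂ _xor_ (∧-zeroʳ (f Fin.zero)) (xorSum-unit (f ∘ Fin.suc) l)

⟨⟩-⊕ʳ : ∀ {n} (r x y : Vec2 n) → ⟨ r , x ⊕ y ⟩ ≡ ⟨ r , x ⟩ xor ⟨ r , y ⟩
⟨⟩-⊕ʳ r x y =
  trans (xorSum-cong (λ j → ∧-distribˡ-xor (r j) (x j) (y j))) (xorSum-xor (λ j → r j ∧ x j) (λ j → r j ∧ y j))

⟨⟩-unitʳ : ∀ {n} (x : Vec2 n) (k : Fin n) → ⟨ x , unit k ⟩ ≡ x k
⟨⟩-unitʳ x k = trans (xorSum-cong (λ j → cong (x j ∧_) (unit-sym k j))) (xorSum-unit x k)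

bit-mono : ∀ {a b : Bool} → (a ≡ true → b ≡ true) → (if a then 1 else 0) ≤ (if b then 1 else 0)
bit-mono {false} {b}     _ = z≤n
bit-mono {true}  {true}  _ = ≤-reflexive refl
bit-mono {true}  {false} h with () ← h refl

weight-mono : ∀ {n} {x y : Vec2 n} → x ⊑ y → weight x ≤ weight y
weight-mono {zero}  _   = z≤n
weight-mono {suc n} x⊑y = +-mono-≤ (bit-mono (x⊑y Fin.zero)) (weight-mono (x⊑y ∘ Fin.suc))

indicator : ∀ {n} → List (Fin n) → Vec2 n
indicator []       = 𝟎
indicator (k ∷ ks) = insert k (indicator ks)

∈⇒indicator : ∀ {n} {j : Fin n} {ks} → j ∈ ks → indicator ks j ≡ true
∈⇒indicator {j = j} {_ ∷ ks} (here refl) = cong (_∨ indicator ks j) (unit-self j)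
∈⇒indicator {ks = k ∷ ks} (there j∈ks) = ρ⊑insert k (indicator ks) _ (∈⇒indicator j∈ks)

indicator⇒∈ : ∀ {n} {j : Fin n} {ks} → indicator ks j ≡ true → j ∈ ks
indicator⇒∈ {j = j} {k ∷ ks} h with unit k j in u
... | true  = here (sym (unit⇒≡ u))
... | false = there (indicator⇒∈ h)

support : ∀ {n} → Vec2 n → List (Fin n)
support {n} σ = filter (λ j → σ j ≟ true) (allFin n)

⊑indicator-support : ∀ {n} (σ : Vec2 n) → σ ⊑ indicator (support σ)
⊑indicator-support σ j σⱼ = ∈⇒indicator (∈-filter⁺ (λ l → σ l ≟ true) (∈-allFin j) σⱼ)

indicator-support⊑ : ∀ {n} (σ : Vec2 n) → indicator (support σ) ⊑ σ
indicator-support⊑ {n} σ j h =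
  proj₂ (∈-filter⁻ (λ l → σ l ≟ true) {xs = allFin n} (indicator⇒∈ h))

combination : ∀ {m n} → (Fin m → Bool) → (Fin m → Vec2 n) → Vec2 n
combination c v l = xorSum (λ j → c j ∧ v j l)

ProjectsOnto : ∀ {n} → Subset2 n → Vec2 n → Set
ProjectsOnto W ρ = ∀ z → ¬ ¬ (∃ λ w → W w × AgreeOn ρ w z)

ProjectsOnto-mono : ∀ {n} {W : Subset2 n} {ρ ρ′ : Vec2 n} →
                    ρ′ ⊑ ρ → ProjectsOnto W ρ → ProjectsOnto W ρ′
ProjectsOnto-mono ρ′⊑ρ onto z = do
  (w , w∈W , w≈z) ← onto z
  pure (w , w∈W , λ j → w≈z j ∘ ρ′⊑ρ j)

module Projection {n : ℕ} {W : Subset2 n} (W-subspace : IsSubspace W) where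

  private
    W-𝟎 : W 𝟎
    W-𝟎 = proj₁ W-subspace

    W-⊕ : ∀ {x y} → W x → W y → W (x ⊕ y)
    W-⊕ = proj₂ W-subspace _ _

  W-scale : ∀ b {x} → W x → W (λ l → b ∧ x l)
  W-scale false _   = W-𝟎
  W-scale true  x∈W = x∈W

  W-combination : ∀ {m} (c : Fin m → Bool) (v : Fin m → Vec2 n) →
                  (∀ j → W (v j)) → W (combination c v)
  W-combination {zero}  c v _   = W-𝟎
  W-combination {suc m} c v v∈W =
    W-⊕ (W-scale (c Fin.zero) (v∈W Fin.zero))
        (W-combination (c ∘ Fin.suc) (v ∘ Fin.suc) (v∈W ∘ Fin.suc))

  agree-insert : ∀ {k : Fin n} {ρ v z : Vec2 n} → AgreeOn ρ v z → v k ≡ z k → AgreeOn (insert k ρ) v z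
  agree-insert {k} {v = v} {z} v≈z vₖ j h with unit k j in u
  ... | true  = subst (λ l → v l ≡ z l) (unit⇒≡ u) vₖ
  ... | false = v≈z j h

  set-coordinate : ∀ {k ρ z w e} → W w → AgreeOn ρ w z →
                   W e → AgreeOn ρ e 𝟎 → e k ≡ true →
                   ∃ λ w′ → W w′ × AgreeOn (insert k ρ) w′ z
  set-coordinate {k} {ρ} {z} {w} {e} w∈W w≈z e∈W e≈0 eₖ with w k ≟ z k
  ... | yes wₖ = w , w∈W , agree-insert w≈z wₖ
  ... | no wₖ≢zₖ =
    w ⊕ e , W-⊕ w∈W e∈W , agree-insert w⊕e≈z w⊕eₖ
    where
    w⊕e≈z : AgreeOn ρ (w ⊕ e) z
    w⊕e≈z j ρⱼ = trans (cong (w j xor_) (e≈0 j ρⱼ)) (trans (xor-identityʳ (w j)) (w≈z j ρⱼ))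
    w⊕eₖ : w k xor e k ≡ z k
    w⊕eₖ = begin
      w k xor e k  ≡⟨ cong (w k xor_) eₖ ⟩
      w k xor true ≡⟨ trans (xor-comm (w k) true) (true-xor (w k)) ⟩
      not (w k)    ≡⟨ sym (¬-not (wₖ≢zₖ ∘ sym)) ⟩
      z k          ∎

  -- `reduce w` subtracts from w the basis expansion of its restriction to ρ.
  module DualBasis (ρ : Vec2 n) (basis : Fin n → Vec2 n)
                   (basis∈W : ∀ j → W (basis j))
                   (basis≈unit : ∀ j → AgreeOn ρ (basis j) (unit j)) where

    reduce : Vec2 n → Vec2 n
    reduce w = w ⊕ combination (λ j → w j ∧ ρ j) basis

    reduce∈W : ∀ {w} → W w → W (reduce w)
    reduce∈W w∈W = W-⊕ w∈W (W-combination _ basis basis∈W)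

    reduce-vanishes : ∀ w → AgreeOn ρ (reduce w) 𝟎
    reduce-vanishes w l ρₗ = begin
      w l xor xorSum (λ j → (w j ∧ ρ j) ∧ basis j l)
        ≡⟨ cong (w l xor_) (xorSum-cong (λ j → cong ((w j ∧ ρ j) ∧_) (basis≈unit j l ρₗ))) ⟩
      w l xor xorSum (λ j → (w j ∧ ρ j) ∧ unit j l)
        ≡⟨ cong (w l xor_) (xorSum-unit (λ j → w j ∧ ρ j) l) ⟩
      w l xor (w l ∧ ρ l)
        ≡⟨ cong (λ b → w l xor (w l ∧ b)) ρₗ ⟩
      w l xor (w l ∧ true)
        ≡⟨ trans (cong (w l xor_) (∧-identityʳ (w l))) (xor-same (w l)) ⟩
      false ∎

    dual : Fin n → Vec2 n
    dual k = unit k ⊕ (λ j → ρ j ∧ basis j k)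

    ⟨⟩-dual : ∀ w k → ⟨ w , dual k ⟩ ≡ reduce w k
    ⟨⟩-dual w k = begin
      ⟨ w , dual k ⟩
        ≡⟨ ⟨⟩-⊕ʳ w (unit k) _ ⟩
      ⟨ w , unit k ⟩ xor xorSum (λ j → w j ∧ (ρ j ∧ basis j k))
        ≡⟨ cong₂ _xor_ (⟨⟩-unitʳ w k) (xorSum-cong (λ j → sym (∧-assoc (w j) (ρ j) (basis j k)))) ⟩
      reduce w k ∎

    dual∈W⊥ : ∀ k → (∀ e → W e → AgreeOn ρ e 𝟎 → e k ≡ false) → (W ⊥) (dual k)
    dual∈W⊥ k silent w w∈W =
      trans (⟨⟩-dual w k) (silent (reduce w) (reduce∈W w∈W) (reduce-vanishes w))

    dual-self : ∀ {k} → ρ k ≡ false → dual k k ≡ true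
    dual-self {k} ρₖ = cong₂ (λ a b → a xor (b ∧ basis k k)) (unit-self k) ρₖ

    dual⊑insert : ∀ k → dual k ⊑ insert k ρ
    dual⊑insert k j = xor-∧⇒∨ (unit k j) (ρ j)
      where
      xor-∧⇒∨ : ∀ a b {c} → a xor (b ∧ c) ≡ true → a ∨ b ≡ true
      xor-∧⇒∨ true  _    _ = refl
      xor-∧⇒∨ false true _ = refl

  module _ {s : ℕ} (codist : CoDistanceAtLeast W (suc s)) where

    short-not-dual : ∀ {y k} → (W ⊥) y → y k ≡ true → ¬ weight y ≤ s
    short-not-dual {y} {k} y⊥W yₖ short =
      ≤⇒≯ short (codist y y⊥W λ y≡0 → contradiction (trans (sym yₖ) (y≡0 k)) λ ())

    kernel-reaches : ∀ k ρ → weight (insert k ρ) ≤ s → ρ k ≡ false → ProjectsOnto W ρ →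
                     ¬ ¬ (∃ λ e → W e × AgreeOn ρ e 𝟎 × e k ≡ true)
    kernel-reaches k ρ short ρₖ onto unreachable =
      ¬¬-pull-Fin (onto ∘ unit) λ basis →
        let open DualBasis ρ (proj₁ ∘ basis) (proj₁ ∘ proj₂ ∘ basis) (proj₂ ∘ proj₂ ∘ basis)
        in short-not-dual (dual∈W⊥ k silent) (dual-self ρₖ)
             (≤-trans (weight-mono (dual⊑insert k)) short)
      where
      silent : ∀ e → W e → AgreeOn ρ e 𝟎 → e k ≡ false
      silent e e∈W e≈0 with e k in eₖ
      ... | false = refl
      ... | true  = contradiction (e , e∈W , e≈0 , eₖ) unreachable

    extend : ∀ k ρ → weight (insert k ρ) ≤ s → ProjectsOnto W ρ → ProjectsOnto W (insert k ρ)
    extend k ρ short onto with ρ k in ρₖ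
    ... | true  = ProjectsOnto-mono (insert⊑ρ ρₖ) onto
    ... | false = λ z → do
      (w , w∈W , w≈z) ← onto z
      (e , e∈W , e≈0 , eₖ) ← kernel-reaches k ρ short ρₖ onto
      pure (set-coordinate w∈W w≈z e∈W e≈0 eₖ)

    projectsOnto-indicator : ∀ ks → weight (indicator ks) ≤ s → ProjectsOnto W (indicator ks)
    projectsOnto-indicator []       _     z = pure (𝟎 , W-𝟎 , λ _ ())
    projectsOnto-indicator (k ∷ ks) short =
      extend k _ short (projectsOnto-indicator ks
        (≤-trans (weight-mono (ρ⊑insert k (indicator ks))) short))

    projectsOnto-short : ∀ σ → weight σ ≤ s → ProjectsOnto W σ
    projectsOnto-short σ short =
      ProjectsOnto-mono (⊑indicator-support σ)
        (projectsOnto-indicator (support σ)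
          (≤-trans (weight-mono (indicator-support⊑ σ)) short))

is★ : Entry → Bool
is★ ★ = true
is★ 𝟘 = false
is★ 𝟙 = false

stars : ∀ {m n} → Matrix01★ m n → Fin m → Vec2 n
stars A i j = is★ (A i j)

sumℕ-cong : ∀ {n} {f g : Fin n → ℕ} → (∀ j → f j ≡ g j) → sumℕ f ≡ sumℕ g
sumℕ-cong {zero}  _ = refl
sumℕ-cong {suc n} h = cong₂ _+_ (h Fin.zero) (sumℕ-cong (h ∘ Fin.suc))

≤-maxℕ : ∀ {m} (f : Fin m → ℕ) i → f i ≤ maxℕ f
≤-maxℕ f Fin.zero    = m≤m⊔n _ _
≤-maxℕ f (Fin.suc i) = ≤-trans (≤-maxℕ (f ∘ Fin.suc) i) (m≤n⊔m (f Fin.zero) _)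

weight-stars≤maxStars : ∀ {m n} (A : Matrix01★ m n) i → weight (stars A i) ≤ maxStars A
weight-stars≤maxStars A i =
  ≤-trans (≤-reflexive (sumℕ-cong (λ j → bit-is★ (A i j))))
          (≤-maxℕ (λ i → sumℕ (λ j → isStar (A i j))) i)
  where
  bit-is★ : ∀ e → (if is★ e then 1 else 0) ≡ isStar e
  bit-is★ ★ = refl
  bit-is★ 𝟘 = refl
  bit-is★ 𝟙 = refl

Solves : ∀ {m n} → (Fin m → Fin n → Bool) → (Vec2 n → Vec2 m) → Subset2 n
Solves M G x = ∀ i → (M · x) i ≡ G x i

module SolutionSet {m n} {A : Matrix01★ m n} {M : Fin m → Fin n → Bool} {G : Vec2 n → Vec2 m}
                   (G-consistent : IsConsistent A G)
                   {W : Subset2 n} (W-subspace : IsSubspace W) (W-solves : W ⊆ Solves M G)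
                   (W-onto : ∀ i → ProjectsOnto W (stars A i)) where

  G-row : ∀ {i w x} → W w → AgreeOn (stars A i) w x → G x i ≡ ⟨ M i , w ⟩
  G-row {i} {w} {x} w∈W w≈x =
    trans (G-consistent i x w (λ j a★ → sym (w≈x j (cong is★ a★)))) (sym (W-solves w w∈W i))

  G-additive : ∀ i x y → G (x ⊕ y) i ≡ G x i xor G y i
  G-additive i x y = decidable-stable (_ ≟ _) do
    (u , u∈W , u≈x) ← W-onto i x
    (v , v∈W , v≈y) ← W-onto i y
    pure (begin
      G (x ⊕ y) i
        ≡⟨ G-row (proj₂ W-subspace u v u∈W v∈W) (λ j σⱼ → cong₂ _xor_ (u≈x j σⱼ) (v≈y j σⱼ)) ⟩
      ⟨ M i , u ⊕ v ⟩
        ≡⟨ ⟨⟩-⊕ʳ (M i) u v ⟩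
      ⟨ M i , u ⟩ xor ⟨ M i , v ⟩
        ≡⟨ cong₂ _xor_ (sym (G-row u∈W u≈x)) (sym (G-row v∈W v≈y)) ⟩
      G x i xor G y i ∎)

  solutions-subspace : IsSubspace (Solves M G)
  solutions-subspace = W-solves 𝟎 (proj₁ W-subspace) , λ x y x✓ y✓ i → begin
    ⟨ M i , x ⊕ y ⟩           ≡⟨ ⟨⟩-⊕ʳ (M i) x y ⟩
    ⟨ M i , x ⟩ xor ⟨ M i , y ⟩ ≡⟨ cong₂ _xor_ (x✓ i) (y✓ i) ⟩
    G x i xor G y i           ≡⟨ sym (G-additive i x y) ⟩
    G (x ⊕ y) i               ∎

theorem5 : ∀ {m n} (A : Matrix01★ m n) (L : Subset2 n) → IsSolution A L →
    (W : Subset2 n) → IsSubspace W → W ⊆ L → CoDistanceAtLeast W (suc (maxStars A)) →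
    Σ (Subset2 n) λ L' → IsLinearSolution A L' × L ⊆ L'
theorem5 A L (M , G , M-completes , G-consistent , L-solves) W W-subspace W⊆L codist =
  Solves M G ,
  (solutions-subspace , M , G , M-completes , G-consistent , λ _ x✓ → x✓) ,
  L-solves
  where
  W-onto : ∀ i → ProjectsOnto W (stars A i)
  W-onto i = Projection.projectsOnto-short W-subspace codist (stars A i)
               (weight-stars≤maxStars A i)
  open SolutionSet G-consistent W-subspace (λ w → L-solves w ∘ W⊆L w) W-onto
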